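{- Let $H$ be a minimal solution to $k$-DST. Then every vertex $v\in V(H)$ has indegree at most $k$ in $H$.
   Context: An instance of $k$-DST consists of a directed graph $G$ with edge costs, a root vertex $r$, a set of terminals $T\subseteq V(G)$ and an integer $k\ge1$. A feasible solution is a subgraph $H\subseteq G$ that contains $k$ pairwise edge-disjoint directed $r,t$-paths for every $t\in T$. A minimal solution is a feasible solution $H$ such that for every edge $e\in E(H)$, the graph $H\setminus e$ is not feasible. -}

module Defs where

open import Data.Nat using (ℕ; _≤_)
open import Data.Fin using (Fin; _≟_)
open import Data.Fin.Subset using (Subset; _∈_; _∉_; _∩_; _-_; ∣_∣)
open import Data.Vec using (tabulate)
open import Data.List using (List; []; _∷_; map)
open import Data.List.Relation.Unary.All using (All)
open import Data.List.Relation.Unary.Unique.Propositional using (Unique)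
import Data.List.Membership.Propositional as LM
open import Data.Product using (Σ; _×_)
open import Relation.Binary.PropositionalEquality using (_≡_; _≢_)
open import Relation.Nullary using (¬_)
open import Relation.Nullary.Decidable using (⌊_⌋)

record Digraph : Set where
  field
    n    : ℕ
    m    : ℕ
    src  : Fin m → Fin n
    tgt  : Fin m → Fin n
    cost : Fin m → ℕ
open Digraph public

-- A subgraph H ⊆ G is given by its set of edges.
EdgeSet : Digraph → Set
EdgeSet G = Subset (m G)

data IsWalk (G : Digraph) : Fin (n G) → Fin (n G) → List (Fin (m G)) → Set where
  nil  : ∀ {u} → IsWalk G u u []
  cons : ∀ {u v e es} → src G e ≡ u → IsWalk G (tgt G e) v es → IsWalk G u v (e ∷ es)

IsPath : (G : Digraph) → EdgeSet G → Fin (n G) → Fin (n G) → List (Fin (m G)) → Set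
IsPath G H u v es =
  IsWalk G u v es × All (λ e → e ∈ H) es × Unique (u ∷ map (tgt G) es)

HasDisjointPaths : (G : Digraph) → EdgeSet G → ℕ → Fin (n G) → Fin (n G) → Set
HasDisjointPaths G H k r t =
  Σ (Fin k → List (Fin (m G))) λ P →
    (∀ i → IsPath G H r t (P i)) ×
    (∀ i j → i ≢ j → ∀ e → e LM.∈ P i → e LM.∈ P j → ⊥')
  where
    open import Data.Empty renaming (⊥ to ⊥')

Feasible : (G : Digraph) → Fin (n G) → Subset (n G) → ℕ → EdgeSet G → Set
Feasible G r T k H = ∀ t → t ∈ T → HasDisjointPaths G H k r t

Minimal : (G : Digraph) → Fin (n G) → Subset (n G) → ℕ → EdgeSet G → Set
Minimal G r T k H =
  Feasible G r T k H × (∀ e → e ∈ H → ¬ Feasible G r T k (H - e))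

indeg : (G : Digraph) → EdgeSet G → Fin (n G) → ℕ
indeg G H v = ∣ H ∩ tabulate (λ e → ⌊ tgt G e ≟ v ⌋) ∣

module Submission where

-- Write δ(W) for the number of edges of H entering a vertex set W.  By Menger's
-- theorem H is feasible iff δ(W) ≥ k for every W that contains a terminal but not
-- the root r.  For an edge e of H, minimality makes H − e infeasible, so some such W
-- has δ_{H−e}(W) < k ≤ δ_H(W): hence e enters W and δ_H(W) ≤ k (a tight cut for e).
-- δ is submodular, and the union of a tight cut with a set missing r again contains
-- a terminal and misses r, so intersecting with a tight cut never increases δ beyond
-- k.  The intersection Z of the tight cuts of all edges into v therefore has δ(Z) ≤ k,
-- contains v, and misses the tail of every edge into v; each such edge enters Z,
-- whence indeg(v) ≤ δ(Z) ≤ k.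

open import Defs
open import Data.Nat using (ℕ; zero; suc; _+_; _*_; _≤_; _<_; z≤n; s≤s)
open import Data.Nat.Properties hiding (_≟_; suc-injective)
open import Data.Nat.Tactic.RingSolver using (solve-∀)
open import Data.Bool using (Bool; true; false; _∧_; _∨_; not; if_then_else_)
import Data.Bool.Properties as Bool
open import Data.Bool.Properties using (∧-zeroʳ; ∧-identityʳ)
open import Data.Fin using (Fin; zero; suc; _≟_; punchIn)
open import Data.Fin.Properties using (punchInᵢ≢i; suc-injective; any?)
open import Data.Fin.Subset using (Subset; _∩_; _-_; ∣_∣) renaming (_∈_ to _∈ₛ_)
open import Data.Fin.Subset.Properties using (p─⊥≡p) renaming (_∈?_ to _∈ₛ?_)
open import Data.Vec using ([]; _∷_; lookup; tabulate)
open import Data.Vec.Properties using ([]=⇒lookup; lookup⇒[]=; lookup-zipWith; lookup∘tabulate)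
open import Data.Product using (Σ; _×_; _,_; proj₁; proj₂)
open import Data.Sum using (_⊎_; inj₁; inj₂)
open import Data.List using (List; []; _∷_; [_]; _++_; map; allFin)
open import Data.List.Relation.Unary.All as All using (All; []; _∷_)
open import Data.List.Relation.Unary.Any using (here; there)
open import Data.List.Relation.Unary.Unique.Propositional using (Unique)
open import Data.List.Relation.Unary.AllPairs using ([]; _∷_)
open import Data.List.Relation.Unary.Unique.Propositional.Properties using (map⁻; Unique[x∷xs]⇒x∉xs)
open import Data.List.Membership.Propositional using (_∈_; _∉_)
open import Data.List.Membership.Propositional.Properties using (∈-allFin)
open import Data.List.Relation.Unary.All.Properties.Core using (¬Any⇒All¬)
open import Data.Empty using (⊥; ⊥-elim)
open import Function using (_∘_)
open import Relation.Binary.PropositionalEquality hiding ([_])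
open import Relation.Nullary using (¬_; yes; no; contradiction)
open import Relation.Nullary.Decidable using (⌊_⌋; _×-dec_; True; toWitness)
open import Algebra.Properties.CommutativeMonoid.Sum +-0-commutativeMonoid
  using (sum; sum-cong-≗; ∑-distrib-+; ∑-comm; sum-remove; sum-replicate-zero)

χ : Bool → ℕ
χ true  = 1
χ false = 0

combine : ∀ {L R L₁ R₁ L₂ R₂} X → L₁ ≡ R₁ → L₂ ≡ R₂ → L + X ≡ L₁ + L₂ → R₁ + R₂ ≡ R + X → L ≡ R
combine X e₁ e₂ left right = +-cancelʳ-≡ X _ _ (trans left (trans (cong₂ _+_ e₁ e₂) right))

sum-mono : ∀ {m} {f g : Fin m → ℕ} → (∀ i → f i ≤ g i) → sum f ≤ sum g
sum-mono {zero}  f≤g = z≤n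
sum-mono {suc m} f≤g = +-mono-≤ (f≤g zero) (sum-mono (f≤g ∘ suc))

sum-mono-< : ∀ {m} {f g : Fin m → ℕ} → (∀ i → f i ≤ g i) → ∀ j → f j < g j → sum f < sum g
sum-mono-< {suc m} f≤g zero    fj<gj = +-mono-<-≤ fj<gj (sum-mono (f≤g ∘ suc))
sum-mono-< {suc m} f≤g (suc j) fj<gj = +-mono-≤-< (f≤g zero) (sum-mono-< (f≤g ∘ suc) j fj<gj)

sum-χ-≤ : ∀ {m} (p : Fin m → Bool) → sum (χ ∘ p) ≤ m
sum-χ-≤ {zero}  p = z≤n
sum-χ-≤ {suc m} p with p zero
... | true  = s≤s (sum-χ-≤ (p ∘ suc))
... | false = m≤n⇒m≤1+n (sum-χ-≤ (p ∘ suc))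

sum-zero : ∀ {m} {f : Fin m → ℕ} → (∀ i → f i ≡ 0) → sum f ≡ 0
sum-zero {m} f≡0 = trans (sum-cong-≗ f≡0) (sum-replicate-zero m)

sum-update : ∀ {m} (e : Fin m) (g g′ : Fin m → ℕ) → (∀ i → i ≢ e → g′ i ≡ g i) →
  sum g′ + g e ≡ sum g + g′ e
sum-update {suc m} e g g′ agree = begin
  sum g′ + g e                      ≡⟨ cong (_+ g e) (sum-remove {i = e} g′) ⟩
  g′ e + sum (g′ ∘ punchIn e) + g e ≡⟨ cong (λ s → g′ e + s + g e) rest ⟩
  g′ e + sum (g ∘ punchIn e) + g e  ≡⟨ swap (g′ e) (sum (g ∘ punchIn e)) (g e) ⟩
  g e + sum (g ∘ punchIn e) + g′ e  ≡⟨ cong (_+ g′ e) (sum-remove {i = e} g) ⟨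
  sum g + g′ e                      ∎
  where
  open ≡-Reasoning
  rest : sum (g′ ∘ punchIn e) ≡ sum (g ∘ punchIn e)
  rest = sum-cong-≗ (λ i → agree (punchIn e i) (punchInᵢ≢i e i))
  swap : ∀ a s b → a + s + b ≡ b + s + a
  swap = solve-∀

sum-single : ∀ {m} (y : Fin m) (f : Fin m → ℕ) → (∀ i → i ≢ y → f i ≡ 0) → sum f ≡ f y
sum-single {suc m} y f vanish = begin
  sum f                     ≡⟨ sum-remove {i = y} f ⟩
  f y + sum (f ∘ punchIn y) ≡⟨ cong (f y +_) (sum-zero (λ i → vanish (punchIn y i) (punchInᵢ≢i y i))) ⟩
  f y + 0                   ≡⟨ +-identityʳ (f y) ⟩
  f y                       ∎
  where open ≡-Reasoning

∣∣-as-sum : ∀ {m} (p : Subset m) → ∣ p ∣ ≡ sum (χ ∘ lookup p)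
∣∣-as-sum []          = refl
∣∣-as-sum (true ∷ p)  = cong suc (∣∣-as-sum p)
∣∣-as-sum (false ∷ p) = ∣∣-as-sum p

lookup-remove-same : ∀ {m} (H : Subset m) e → lookup (H - e) e ≡ false
lookup-remove-same (_ ∷ H) zero    = refl
lookup-remove-same (_ ∷ H) (suc e) = lookup-remove-same H e

lookup-remove-other : ∀ {m} (H : Subset m) {e e′} → e′ ≢ e → lookup (H - e) e′ ≡ lookup H e′
lookup-remove-other (_ ∷ H) {zero}  {zero}   e′≢e = ⊥-elim (e′≢e refl)
lookup-remove-other (_ ∷ H) {zero}  {suc i}  _    = cong (λ p → lookup p i) (p─⊥≡p H)
lookup-remove-other (_ ∷ H) {suc e} {zero}   _    = refl
lookup-remove-other (_ ∷ H) {suc e} {suc i}  e′≢e = lookup-remove-other H (e′≢e ∘ cong suc)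

all-or-some : ∀ {k} {A B : Fin k → Set} → (∀ i → A i ⊎ B i) → (∀ i → A i) ⊎ Σ (Fin k) B
all-or-some {zero}  choice = inj₁ λ ()
all-or-some {suc k} choice with choice zero | all-or-some (choice ∘ suc)
... | inj₂ b | _            = inj₂ (zero , b)
... | inj₁ _ | inj₂ (i , b) = inj₂ (suc i , b)
... | inj₁ a | inj₁ as      = inj₁ λ { zero → a ; (suc i) → as i }

-- Boolean equality test on a finite type; it is the test used in `indeg`.
_≡ᵇ_ : ∀ {k} → Fin k → Fin k → Bool
x ≡ᵇ y = ⌊ x ≟ y ⌋

≡ᵇ-refl : ∀ {k} (x : Fin k) → (x ≡ᵇ x) ≡ true
≡ᵇ-refl x with x ≟ x
... | yes _   = refl
... | no x≢x = ⊥-elim (x≢x refl)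

≡ᵇ-≢ : ∀ {k} {x y : Fin k} → x ≢ y → (x ≡ᵇ y) ≡ false
≡ᵇ-≢ {x = x} {y} x≢y with x ≟ y
... | yes x≡y = ⊥-elim (x≢y x≡y)
... | no _    = refl

≡ᵇ-sound : ∀ {k} {x y : Fin k} → (x ≡ᵇ y) ≡ true → x ≡ y
≡ᵇ-sound {x = x} {y} x≡ᵇy with x ≟ y
... | yes x≡y = x≡y
≡ᵇ-sound () | no _

∧-true : ∀ {a b} → (a ∧ b) ≡ true → a ≡ true × b ≡ true
∧-true {true} {true} _ = refl , refl

-- Flows.  A (0/1-)flow in G is a set of edges, each carrying one unit.  We only
-- record the balance of units at each vertex, which is all the cut arguments need.
module Flows (G : Digraph) where

  V E Flow : Set
  V    = Fin (n G)
  E    = Fin (m G)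
  Flow = E → Bool

  count : Flow → (E → V) → V → ℕ
  count f p x = sum (λ e → χ (f e ∧ (p e ≡ᵇ x)))

  inflow outflow : Flow → V → ℕ
  inflow  f = count f (tgt G)
  outflow f = count f (src G)

  -- f′ routes one more unit from a to b than f does (balance at every vertex).
  Augments : Flow → Flow → V → V → Set
  Augments f f′ a b = ∀ x →
    inflow f′ x + outflow f x + χ (a ≡ᵇ x) ≡ inflow f x + outflow f′ x + χ (b ≡ᵇ x)

  record IsFlow (f : Flow) (j : ℕ) (r t : V) : Set where
    constructor isFlow
    field balance : ∀ x → inflow f x + j * χ (r ≡ᵇ x) ≡ outflow f x + j * χ (t ≡ᵇ x)
  open IsFlow

  empty-isFlow : ∀ r t → IsFlow (λ _ → false) 0 r t
  empty-isFlow r t = isFlow λ x → begin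
    inflow (λ _ → false) x + 0  ≡⟨ +-identityʳ _ ⟩
    inflow (λ _ → false) x      ≡⟨ sum-zero {m G} (λ _ → refl) ⟩
    0                           ≡⟨ sum-zero {m G} (λ _ → refl) ⟨
    outflow (λ _ → false) x     ≡⟨ +-identityʳ _ ⟨
    outflow (λ _ → false) x + 0 ∎
    where open ≡-Reasoning

  augments-trans : ∀ {f f₁ f₂ a b c} → Augments f f₁ a b → Augments f₁ f₂ b c → Augments f f₂ a c
  augments-trans {f} {f₁} {f₂} {a} {b} {c} h₁ h₂ x =
    compose (inflow f x) (outflow f x) (χ (a ≡ᵇ x)) (inflow f₁ x) (outflow f₁ x) (χ (b ≡ᵇ x))
            (inflow f₂ x) (outflow f₂ x) (χ (c ≡ᵇ x)) (h₁ x) (h₂ x)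
    where
    compose : ∀ i o A i₁ o₁ B i₂ o₂ C → i₁ + o + A ≡ i + o₁ + B → i₂ + o₁ + B ≡ i₁ + o₂ + C →
              i₂ + o + A ≡ i + o₂ + C
    compose i o A i₁ o₁ B i₂ o₂ C e₁ e₂ = combine (i₁ + o₁ + B) e₂ e₁ (shuffle i₂ o A i₁ o₁ B) (shuffle′ i₁ o₂ C i o₁ B)
      where
      shuffle : ∀ i₂ o A i₁ o₁ B → i₂ + o + A + (i₁ + o₁ + B) ≡ (i₂ + o₁ + B) + (i₁ + o + A)
      shuffle = solve-∀
      shuffle′ : ∀ i₁ o₂ C i o₁ B → (i₁ + o₂ + C) + (i + o₁ + B) ≡ i + o₂ + C + (i₁ + o₁ + B)
      shuffle′ = solve-∀

  augments-trans′ : ∀ {f f₁ f₂ a b c} → Augments f f₁ b c → Augments f₁ f₂ a b → Augments f f₂ a c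
  augments-trans′ {f} {f₁} {f₂} {a} {b} {c} h₁ h₂ x =
    compose (inflow f x) (outflow f x) (χ (a ≡ᵇ x)) (inflow f₁ x) (outflow f₁ x) (χ (b ≡ᵇ x))
            (inflow f₂ x) (outflow f₂ x) (χ (c ≡ᵇ x)) (h₁ x) (h₂ x)
    where
    compose : ∀ i o A i₁ o₁ B i₂ o₂ C → i₁ + o + B ≡ i + o₁ + C → i₂ + o₁ + A ≡ i₁ + o₂ + B →
              i₂ + o + A ≡ i + o₂ + C
    compose i o A i₁ o₁ B i₂ o₂ C e₁ e₂ = combine (i₁ + o₁ + B) e₂ e₁ (shuffle i₂ o A i₁ o₁ B) (shuffle′ i₁ o₂ B i o₁ C)
      where
      shuffle : ∀ i₂ o A i₁ o₁ B → i₂ + o + A + (i₁ + o₁ + B) ≡ (i₂ + o₁ + A) + (i₁ + o + B)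
      shuffle = solve-∀
      shuffle′ : ∀ i₁ o₂ B i o₁ C → (i₁ + o₂ + B) + (i + o₁ + C) ≡ i + o₂ + C + (i₁ + o₁ + B)
      shuffle′ = solve-∀

  isFlow-augment : ∀ {f f′ j r t} → Augments f f′ r t → IsFlow f j r t → IsFlow f′ (suc j) r t
  isFlow-augment {f} {f′} {j} {r} {t} aug flow = isFlow λ x →
    step (inflow f′ x) (outflow f x) (χ (r ≡ᵇ x)) (inflow f x) (outflow f′ x) (χ (t ≡ᵇ x)) (aug x) (balance flow x)
    where
    step : ∀ i′ o R i o′ T → i′ + o + R ≡ i + o′ + T → i + j * R ≡ o + j * T →
           i′ + (R + j * R) ≡ o′ + (T + j * T)
    step i′ o R i o′ T e₁ e₂ = combine (i + o) e₁ e₂ (shuffle i′ o R i j) (shuffle′ i o′ T o j)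
      where
      shuffle : ∀ i′ o R i j → i′ + (R + j * R) + (i + o) ≡ (i′ + o + R) + (i + j * R)
      shuffle = solve-∀
      shuffle′ : ∀ i o′ T o j → (i + o′ + T) + (o + j * T) ≡ o′ + (T + j * T) + (i + o)
      shuffle′ = solve-∀

  isFlow-diminish : ∀ {f f′ j r t} → Augments f f′ t r → IsFlow f (suc j) r t → IsFlow f′ j r t
  isFlow-diminish {f} {f′} {j} {r} {t} aug flow = isFlow λ x →
    step (inflow f′ x) (outflow f x) (χ (r ≡ᵇ x)) (inflow f x) (outflow f′ x) (χ (t ≡ᵇ x)) (aug x) (balance flow x)
    where
    step : ∀ i′ o R i o′ T → i′ + o + T ≡ i + o′ + R → i + (R + j * R) ≡ o + (T + j * T) →
           i′ + j * R ≡ o′ + j * T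
    step i′ o R i o′ T e₁ e₂ = combine (i + o + R + T) e₁ e₂ (shuffle i′ o R i j T) (shuffle′ i o′ R o j T)
      where
      shuffle : ∀ i′ o R i j T → i′ + j * R + (i + o + R + T) ≡ (i′ + o + T) + (i + (R + j * R))
      shuffle = solve-∀
      shuffle′ : ∀ i o′ R o j T → (i + o′ + R) + (o + (T + j * T)) ≡ o′ + j * T + (i + o + R + T)
      shuffle′ = solve-∀

  toggle : Flow → E → Flow
  toggle f e e′ = if e′ ≡ᵇ e then not (f e′) else f e′

  toggle-other : ∀ f {e e′} → e′ ≢ e → toggle f e e′ ≡ f e′
  toggle-other f e′≢e rewrite ≡ᵇ-≢ e′≢e = refl

  toggle-same : ∀ f e → toggle f e e ≡ not (f e)
  toggle-same f e rewrite ≡ᵇ-refl e = refl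

  count-toggle : ∀ f e p x →
    count (toggle f e) p x + χ (f e ∧ (p e ≡ᵇ x)) ≡ count f p x + χ (not (f e) ∧ (p e ≡ᵇ x))
  count-toggle f e p x =
    trans (sum-update e (λ e′ → χ (f e′ ∧ (p e′ ≡ᵇ x))) (λ e′ → χ (toggle f e e′ ∧ (p e′ ≡ᵇ x)))
                      (λ e′ e′≢e → cong (λ b → χ (b ∧ (p e′ ≡ᵇ x))) (toggle-other f e′≢e)))
          (cong (λ b → count f p x + χ (b ∧ (p e ≡ᵇ x))) (toggle-same f e))

  toggle-on : ∀ {f e} → f e ≡ false → ∀ p x → count (toggle f e) p x ≡ count f p x + χ (p e ≡ᵇ x)
  toggle-on {f} {e} fe p x with count-toggle f e p x
  ... | counted rewrite fe = trans (sym (+-identityʳ _)) counted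

  toggle-off : ∀ {f e} → f e ≡ true → ∀ p x → count f p x ≡ count (toggle f e) p x + χ (p e ≡ᵇ x)
  toggle-off {f} {e} fe p x with count-toggle f e p x
  ... | counted rewrite fe = sym (trans counted (+-identityʳ _))

  toggle-adds : ∀ {f e} → f e ≡ false → Augments f (toggle f e) (src G e) (tgt G e)
  toggle-adds {f} {e} fe x = begin
    inflow (toggle f e) x + outflow f x + S  ≡⟨ cong (λ i → i + outflow f x + S) (toggle-on fe (tgt G) x) ⟩
    inflow f x + T + outflow f x + S         ≡⟨ shuffle (inflow f x) (outflow f x) S T ⟩
    inflow f x + (outflow f x + S) + T       ≡⟨ cong (λ o → inflow f x + o + T) (toggle-on fe (src G) x) ⟨
    inflow f x + outflow (toggle f e) x + T  ∎
    where
    open ≡-Reasoning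
    S T : ℕ
    S = χ (src G e ≡ᵇ x)
    T = χ (tgt G e ≡ᵇ x)
    shuffle : ∀ i o S T → i + T + o + S ≡ i + (o + S) + T
    shuffle = solve-∀

  toggle-removes : ∀ {f e} → f e ≡ true → Augments f (toggle f e) (tgt G e) (src G e)
  toggle-removes {f} {e} fe x = begin
    inflow f′ x + outflow f x + T            ≡⟨ cong (λ o → inflow f′ x + o + T) (toggle-off fe (src G) x) ⟩
    inflow f′ x + (outflow f′ x + S) + T     ≡⟨ shuffle (inflow f′ x) (outflow f′ x) S T ⟩
    inflow f′ x + T + outflow f′ x + S       ≡⟨ cong (λ i → i + outflow f′ x + S) (toggle-off fe (tgt G) x) ⟨
    inflow f x + outflow f′ x + S            ∎
    where
    open ≡-Reasoning
    f′ : Flow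
    f′ = toggle f e
    S T : ℕ
    S = χ (src G e ≡ᵇ x)
    T = χ (tgt G e ≡ᵇ x)
    shuffle : ∀ i o S T → i + (o + S) + T ≡ i + T + o + S
    shuffle = solve-∀

  toggleAll : Flow → List E → Flow
  toggleAll f []       = f
  toggleAll f (e ∷ es) = toggleAll (toggle f e) es

  toggleAll-∉ : ∀ f es {e} → e ∉ es → toggleAll f es e ≡ f e
  toggleAll-∉ f []       e∉ = refl
  toggleAll-∉ f (e′ ∷ es) e∉ =
    trans (toggleAll-∉ (toggle f e′) es (e∉ ∘ there)) (toggle-other f (e∉ ∘ here))

  toggleAll-∈ : ∀ f {es e} → Unique es → e ∈ es → toggleAll f es e ≡ not (f e)
  toggleAll-∈ f {e ∷ es} uniq (here refl) =
    trans (toggleAll-∉ (toggle f e) es (Unique[x∷xs]⇒x∉xs uniq)) (toggle-same f e)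
  toggleAll-∈ f {e′ ∷ es} (e′≢ ∷ uniq) (there e∈es) =
    trans (toggleAll-∈ (toggle f e′) uniq e∈es) (cong not (toggle-other f (≢-sym (All.lookup e′≢ e∈es))))

  sumOver : (V → Bool) → (V → ℕ) → ℕ
  sumOver W g = sum (λ x → if W x then g x else 0)

  sumOver-+ : ∀ W (g h : V → ℕ) → sumOver W (λ x → g x + h x) ≡ sumOver W g + sumOver W h
  sumOver-+ W g h = trans (sum-cong-≗ (λ x → if-+ (W x)))
                          (∑-distrib-+ (λ x → if W x then g x else 0) (λ x → if W x then h x else 0))
    where
    if-+ : ∀ {x} b → (if b then g x + h x else 0) ≡ (if b then g x else 0) + (if b then h x else 0)
    if-+ true  = refl
    if-+ false = refl

  sumOver-point : ∀ W j a → sumOver W (λ x → j * χ (a ≡ᵇ x)) ≡ (if W a then j else 0)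
  sumOver-point W j a =
    trans (sum-single a _ (λ x x≢a → off (W x) (≡ᵇ-≢ (≢-sym x≢a))))
          (on (W a) (≡ᵇ-refl a))
    where
    off : ∀ {x} b → (a ≡ᵇ x) ≡ false → (if b then j * χ (a ≡ᵇ x) else 0) ≡ 0
    off {x} true  a≢x rewrite a≢x = *-zeroʳ j
    off     false _   = refl
    on : ∀ b → (a ≡ᵇ a) ≡ true → (if b then j * χ (a ≡ᵇ a) else 0) ≡ (if b then j else 0)
    on true  a≡a rewrite a≡a = *-identityʳ j
    on false _   = refl

  count-over : ∀ f W p → sumOver W (count f p) ≡ sum (λ e → χ (f e ∧ W (p e)))
  count-over f W p = begin
    sum (λ x → if W x then sum (λ e → hits x e) else 0) ≡⟨ sum-cong-≗ (λ x → if-sum (W x) (hits x)) ⟩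
    sum (λ x → sum (λ e → if W x then hits x e else 0)) ≡⟨ ∑-comm (λ x e → if W x then hits x e else 0) ⟩
    sum (λ e → sum (λ x → if W x then hits x e else 0)) ≡⟨ sum-cong-≗ (λ e → sum-single (p e) _ (off e)) ⟩
    sum (λ e → if W (p e) then hits (p e) e else 0)     ≡⟨ sum-cong-≗ on ⟩
    sum (λ e → χ (f e ∧ W (p e)))                    ∎
    where
    open ≡-Reasoning
    hits : V → E → ℕ
    hits x e = χ (f e ∧ (p e ≡ᵇ x))
    if-sum : ∀ b (g : E → ℕ) → (if b then sum g else 0) ≡ sum (λ e → if b then g e else 0)
    if-sum true  g = refl
    if-sum false g = sym (sum-zero {m G} (λ _ → refl))
    off : ∀ e x → x ≢ p e → (if W x then hits x e else 0) ≡ 0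
    off e x x≢pe rewrite ≡ᵇ-≢ (≢-sym x≢pe) with W x | f e
    ... | true  | true  = refl
    ... | true  | false = refl
    ... | false | _     = refl
    on : ∀ e → (if W (p e) then hits (p e) e else 0) ≡ χ (f e ∧ W (p e))
    on e rewrite ≡ᵇ-refl (p e) with W (p e) | f e
    ... | true  | true  = refl
    ... | true  | false = refl
    ... | false | true  = refl
    ... | false | false = refl

  flow-across-cut : ∀ {f j r t} (W : V → Bool) → IsFlow f j r t → W r ≡ false → W t ≡ true →
    sum (λ e → χ (f e ∧ W (tgt G e))) ≡ sum (λ e → χ (f e ∧ W (src G e))) + j
  flow-across-cut {f} {j} {r} {t} W flow r∉W t∈W = begin
    sum (λ e → χ (f e ∧ W (tgt G e)))
      ≡⟨ +-identityʳ _ ⟨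
    sum (λ e → χ (f e ∧ W (tgt G e))) + 0
      ≡⟨ cong₂ _+_ (count-over f W (tgt G)) (trans (sumOver-point W j r) (cong (λ b → if b then j else 0) r∉W)) ⟨
    sumOver W (inflow f) + sumOver W (λ x → j * χ (r ≡ᵇ x))
      ≡⟨ sumOver-+ W (inflow f) _ ⟨
    sumOver W (λ x → inflow f x + j * χ (r ≡ᵇ x))
      ≡⟨ sum-cong-≗ (λ x → cong (λ v → if W x then v else 0) (balance flow x)) ⟩
    sumOver W (λ x → outflow f x + j * χ (t ≡ᵇ x))
      ≡⟨ sumOver-+ W (outflow f) _ ⟩
    sumOver W (outflow f) + sumOver W (λ x → j * χ (t ≡ᵇ x))
      ≡⟨ cong₂ _+_ (count-over f W (src G)) (trans (sumOver-point W j t) (cong (λ b → if b then j else 0) t∈W)) ⟩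
    sum (λ e → χ (f e ∧ W (src G e))) + j ∎
    where open ≡-Reasoning

-- Walks and reachability in an auxiliary digraph on Fin n with edges Fin m, in which
-- edge e runs from s e to t e and may be used only if allowed e ≡ true.  Subgraphs
-- and flows of G, as well as the residual graphs of the augmenting-path method, are
-- of this form.
module Walks {n m : ℕ} (allowed : Fin m → Bool) (s t : Fin m → Fin n) where
  open import Data.List.Membership.DecPropositional (_≟_ {n}) using (_∈?_)

  data Walk : Fin n → Fin n → List (Fin m) → Set where
    nil  : ∀ {a} → Walk a a []
    cons : ∀ {a b e es} → allowed e ≡ true → s e ≡ a → Walk (t e) b es → Walk a b (e ∷ es)

  walk-snoc : ∀ {a b es e} → Walk a b es → allowed e ≡ true → s e ≡ b → Walk a (t e) (es ++ [ e ])
  walk-snoc nil              ok se≡b = cons ok se≡b nil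
  walk-snoc (cons ok′ se≡ w) ok se≡b = cons ok′ se≡ (walk-snoc w ok se≡b)

  walk-allowed : ∀ {a b es} → Walk a b es → All (λ e → allowed e ≡ true) es
  walk-allowed nil           = []
  walk-allowed (cons ok _ w) = ok ∷ walk-allowed w

  Closed : (Fin n → Bool) → Set
  Closed R = ∀ e → allowed e ≡ true → R (s e) ≡ true → R (t e) ≡ true

  Reach : Fin n → Fin n → Set
  Reach x y = Σ (List (Fin m)) (Walk x y)
            ⊎ Σ (Fin n → Bool) (λ R → R x ≡ true × R y ≡ false × Closed R)

  ReachableFrom : Fin n → (Fin n → Bool) → Set
  ReachableFrom x R = ∀ z → R z ≡ true → Σ (List (Fin m)) (Walk x z)

  extend-reachable : ∀ {x R e} → ReachableFrom x R → allowed e ≡ true → R (s e) ≡ true →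
    ReachableFrom x (λ z → R z ∨ (z ≡ᵇ t e))
  extend-reachable {R = R} {e} reachable ok se∈R z z∈R′ with R z in z∈R
  ... | true  = reachable z z∈R
  ... | false with ≡ᵇ-sound z∈R′
  ...   | refl with reachable (s e) se∈R
  ...     | es , w = es ++ [ e ] , walk-snoc w ok refl

  extend-grows : ∀ (R : Fin n → Bool) y → R y ≡ false →
    sum (χ ∘ R) < sum (λ z → χ (R z ∨ (z ≡ᵇ y)))
  extend-grows R y y∉R = sum-mono-< (λ z → χ-∨ (R z) (z ≡ᵇ y)) y grows
    where
    χ-∨ : ∀ a b → χ a ≤ χ (a ∨ b)
    χ-∨ true  _     = ≤-refl
    χ-∨ false true  = z≤n
    χ-∨ false false = z≤n
    grows : χ (R y) < χ (R y ∨ (y ≡ᵇ y))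
    grows rewrite y∉R | ≡ᵇ-refl y = s≤s z≤n

  -- Graph search: grow R from {x} until it contains y or is closed.  As R grows in
  -- every round, n < |R| + fuel guarantees termination.
  search : ∀ {x} y fuel (R : Fin n → Bool) → ReachableFrom x R → n < sum (χ ∘ R) + fuel →
    R x ≡ true → Reach x y
  search y fuel R reachable bound x∈R with R y in y∈R
  ... | true  = inj₁ (reachable y y∈R)
  ... | false with any? (λ e → (allowed e Bool.≟ true) ×-dec (R (s e) Bool.≟ true) ×-dec (R (t e) Bool.≟ false))
  ...   | no ¬leaving = inj₂ (R , x∈R , y∈R , closed)
    where
    closed : Closed R
    closed e ok se∈R with R (t e) in te∈R
    ... | true  = refl
    ... | false = ⊥-elim (¬leaving (e , ok , se∈R , te∈R))
  search y zero R reachable bound x∈R | false | yes _ =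
    ⊥-elim (<⇒≱ bound (≤-trans (≤-reflexive (+-identityʳ _)) (sum-χ-≤ R)))
  search y (suc fuel) R reachable bound x∈R | false | yes (e , ok , se∈R , te∉R) =
    search y fuel (λ z → R z ∨ (z ≡ᵇ t e)) (extend-reachable reachable ok se∈R) bound′
           (cong (_∨ _) x∈R)
    where
    bound′ : n < sum (λ z → χ (R z ∨ (z ≡ᵇ t e))) + fuel
    bound′ = ≤-trans bound (≤-trans (≤-reflexive (+-suc _ fuel)) (+-monoˡ-≤ fuel (extend-grows R (t e) te∉R)))

  reach : ∀ x y → Reach x y
  reach x y = search y (suc n) (_≡ᵇ x) start (m≤n+m (suc n) _) (≡ᵇ-refl x)
    where
    start : ReachableFrom x (_≡ᵇ x)
    start z z≡ᵇx with ≡ᵇ-sound z≡ᵇx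
    ... | refl = [] , nil

  Simple : Fin n → List (Fin m) → Set
  Simple a es = Unique (a ∷ map t es)

  simple⇒unique : ∀ {a es} → Simple a es → Unique es
  simple⇒unique (_ ∷ distinct) = map⁻ distinct

  suffix : ∀ {a c b es} → Walk c b es → Simple c es → a ∈ (c ∷ map t es) →
    Σ (List (Fin m)) λ es′ → Walk a b es′ × Simple a es′
  suffix w              simple        (here refl) = _ , w , simple
  suffix (cons _ _ w)   (_ ∷ simple)  (there a∈)  = suffix w simple a∈

  shorten : ∀ {a b es} → Walk a b es → Σ (List (Fin m)) λ es′ → Walk a b es′ × Simple a es′
  shorten nil = [] , nil , [] ∷ []
  shorten {a} (cons {e = e} ok se≡a w) with shorten w
  ... | es′ , w′ , simple with a ∈? (t e ∷ map t es′)
  ...   | yes a∈ = suffix w′ simple a∈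
  ...   | no a∉  = e ∷ es′ , cons ok se≡a w′ , ¬Any⇒All¬ _ a∉ ∷ simple

module Augmentation (G : Digraph) where
  open Flows G

  -- Traversing e from s e to t e is either using e forwards while f does not
  -- use it, or using it backwards while f does.
  Oriented : (E → V) → (E → V) → E → Bool → Set
  Oriented s t e false = s e ≡ src G e × t e ≡ tgt G e
  Oriented s t e true  = s e ≡ tgt G e × t e ≡ src G e

  toggle-oriented : ∀ {s t} f e → Oriented s t e (f e) → Augments f (toggle f e) (s e) (t e)
  toggle-oriented {s} {t} f e oriented with f e in fe | oriented
  ... | false | s≡ , t≡ = subst₂ (Augments f (toggle f e)) (sym s≡) (sym t≡) (toggle-adds fe)
  ... | true  | s≡ , t≡ = subst₂ (Augments f (toggle f e)) (sym s≡) (sym t≡) (toggle-removes fe)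

  toggle-preserves : ∀ (P : E → Bool → Set) f {e es} → All (e ≢_) es →
    All (λ e′ → P e′ (f e′)) es → All (λ e′ → P e′ (toggle f e e′)) es
  toggle-preserves P f []           []       = []
  toggle-preserves P f (e≢e′ ∷ e∉)  (p ∷ ps) =
    subst (P _) (sym (toggle-other f (≢-sym e≢e′))) p ∷ toggle-preserves P f e∉ ps

  augment-along : ∀ {allowed s t} f {a b es} → Walks.Walk allowed s t a b es → Unique es →
    All (λ e → Oriented s t e (f e)) es → Augments f (toggleAll f es) a b
  augment-along f Walks.nil _ [] x = refl
  augment-along {s = s} {t} f (Walks.cons {e = e} _ refl w) (e∉ ∷ uniq) (o ∷ os) =
    augments-trans (toggle-oriented f e o)
                   (augment-along (toggle f e) w uniq (toggle-preserves (Oriented s t) f e∉ os))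

  remove-along : ∀ f {a b es} → IsWalk G a b es → Unique es → All (λ e → f e ≡ true) es →
    Augments f (toggleAll f es) b a
  remove-along f nil _ [] x = refl
  remove-along f (cons {e = e} refl w) (e∉ ∷ uniq) (fe ∷ fes) =
    augments-trans′ (toggle-removes fe)
                    (remove-along (toggle f e) w uniq (toggle-preserves (λ _ b → b ≡ true) f e∉ fes))

module Cuts (G : Digraph) where
  open Flows G using (V; E)

  entering : (E → Bool) → (V → Bool) → ℕ
  entering h W = sum (λ e → χ (h e ∧ not (W (src G e)) ∧ W (tgt G e)))

  entering-cong : ∀ h {W W′} → (∀ x → W x ≡ W′ x) → entering h W ≡ entering h W′
  entering-cong h W≗W′ = sum-cong-≗ (λ e → cong₂ (λ a b → χ (h e ∧ not a ∧ b)) (W≗W′ (src G e)) (W≗W′ (tgt G e)))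

  entering-full : ∀ h {W} → (∀ x → W x ≡ true) → entering h W ≡ 0
  entering-full h {W} full = sum-zero (λ e → trans (cong (λ b → χ (h e ∧ not b ∧ W (tgt G e))) (full (src G e)))
                                                 (cong χ (∧-zeroʳ (h e))))

  edges : EdgeSet G → E → Bool
  edges H = lookup H

  entering-remove : ∀ {H e} → e ∈ₛ H → ∀ W →
    entering (edges (H - e)) W + χ (not (W (src G e)) ∧ W (tgt G e)) ≡ entering (edges H) W
  entering-remove {H} {e} e∈H W =
    trans (cong (λ b → entering (edges (H - e)) W + χ (b ∧ not (W (src G e)) ∧ W (tgt G e))) (sym ([]=⇒lookup e∈H)))
   (trans (sum-update e (term H) (term (H - e)) (λ e′ e′≢e → cong (λ b → χ (b ∧ _)) (lookup-remove-other H e′≢e)))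
          (trans (cong (λ b → entering (edges H) W + χ (b ∧ _)) (lookup-remove-same H e)) (+-identityʳ _)))
    where
    term : EdgeSet G → E → ℕ
    term H′ e′ = χ (lookup H′ e′ ∧ not (W (src G e′)) ∧ W (tgt G e′))

  -- The entering-edge count is submodular: an edge entering W ∧ Z or W ∨ Z enters W
  -- or Z, and an edge entering both W ∧ Z and W ∨ Z enters both W and Z.
  entering-submodular : ∀ h W Z →
    entering h (λ x → W x ∧ Z x) + entering h (λ x → W x ∨ Z x) ≤ entering h W + entering h Z
  entering-submodular h W Z = begin
    entering h (λ x → W x ∧ Z x) + entering h (λ x → W x ∨ Z x)
      ≡⟨ ∑-distrib-+ (λ e → enters (h e) (W (src G e) ∧ Z (src G e)) (W (tgt G e) ∧ Z (tgt G e))) _ ⟨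
    sum (λ e → enters (h e) (W (src G e) ∧ Z (src G e)) (W (tgt G e) ∧ Z (tgt G e))
             + enters (h e) (W (src G e) ∨ Z (src G e)) (W (tgt G e) ∨ Z (tgt G e)))
      ≤⟨ sum-mono (λ e → pointwise (h e) (W (src G e)) (W (tgt G e)) (Z (src G e)) (Z (tgt G e))) ⟩
    sum (λ e → enters (h e) (W (src G e)) (W (tgt G e)) + enters (h e) (Z (src G e)) (Z (tgt G e)))
      ≡⟨ ∑-distrib-+ (λ e → enters (h e) (W (src G e)) (W (tgt G e))) _ ⟩
    entering h W + entering h Z ∎
    where
    open ≤-Reasoning
    enters : Bool → Bool → Bool → ℕ
    enters hb ins int = χ (hb ∧ not ins ∧ int)
    -- A closed inequality between numerals, checked by evaluation.
    decide : ∀ {a b} {ok : True (a ≤? b)} → a ≤ b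
    decide {ok = ok} = toWitness ok
    pointwise : ∀ hb ws wt zs zt →
      enters hb (ws ∧ zs) (wt ∧ zt) + enters hb (ws ∨ zs) (wt ∨ zt) ≤ enters hb ws wt + enters hb zs zt
    pointwise false _     _     _     _     = z≤n
    pointwise true  true  true  true  true  = decide
    pointwise true  true  true  true  false = decide
    pointwise true  true  true  false true  = decide
    pointwise true  true  true  false false = decide
    pointwise true  true  false true  true  = decide
    pointwise true  true  false true  false = decide
    pointwise true  true  false false true  = decide
    pointwise true  true  false false false = decide
    pointwise true  false true  true  true  = decide
    pointwise true  false true  true  false = decide
    pointwise true  false true  false true  = decide
    pointwise true  false true  false false = decide
    pointwise true  false false true  true  = decide
    pointwise true  false false true  false = decide
    pointwise true  false false false true  = decide
    pointwise true  false false false false = decide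

-- Menger's theorem for edge-disjoint paths, proved by the augmenting-path method.
module Menger (G : Digraph) where
  open Flows G
  open Cuts G
  open Augmentation G
  open Walks using (nil; cons)
  open import Data.List.Membership.DecPropositional (_≟_ {m G}) using (_∈?_)

  PathWithin : (E → Set) → V → V → List E → Set
  PathWithin P r t es = IsWalk G r t es × All P es × Unique (r ∷ map (tgt G) es)

  DisjointPaths : (E → Set) → ℕ → V → V → Set
  DisjointPaths P k r t = Σ (Fin k → List E) λ paths →
    (∀ i → PathWithin P r t (paths i)) ×
    (∀ i j → i ≢ j → ∀ e → e ∈ paths i → e ∈ paths j → ⊥)

  disjointPaths-weaken : ∀ {P Q k r t} → (∀ e → P e → Q e) → DisjointPaths P k r t → DisjointPaths Q k r t
  disjointPaths-weaken P⊆Q (paths , ok , disjoint) =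
    paths , (λ i → let (w , inP , simple) = ok i in w , All.map (P⊆Q _) inP , simple) , disjoint

  add-path : ∀ {A B : E → Set} {j r t p} → PathWithin A r t p → (∀ e → B e → A e) →
    (∀ {e} → e ∈ p → ¬ B e) → DisjointPaths B j r t → DisjointPaths A (suc j) r t
  add-path {p = p} path B⊆A avoid (paths , ok , disjoint) = paths′ , ok′ , disjoint′
    where
    paths′ : Fin (suc _) → List _
    paths′ zero    = p
    paths′ (suc i) = paths i
    ok′ : ∀ i → PathWithin _ _ _ (paths′ i)
    ok′ zero    = path
    ok′ (suc i) = let (w , inB , simple) = ok i in w , All.map (B⊆A _) inB , simple
    disjoint′ : ∀ i j → i ≢ j → ∀ e → e ∈ paths′ i → e ∈ paths′ j → ⊥
    disjoint′ zero    zero    i≢j _ _  _  = i≢j refl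
    disjoint′ zero    (suc j) _   e e∈ e∈′ = avoid e∈ (All.lookup (proj₁ (proj₂ (ok j))) e∈′)
    disjoint′ (suc i) zero    _   e e∈ e∈′ = avoid e∈′ (All.lookup (proj₁ (proj₂ (ok i))) e∈)
    disjoint′ (suc i) (suc j) i≢j = disjoint i j (i≢j ∘ cong suc)

  isWalk⇒walk : ∀ {allowed a b es} → IsWalk G a b es → All (λ e → allowed e ≡ true) es →
    Walks.Walk allowed (src G) (tgt G) a b es
  isWalk⇒walk nil         []         = nil
  isWalk⇒walk (cons se w) (ok ∷ oks) = cons ok se (isWalk⇒walk w oks)

  walk⇒isWalk : ∀ {allowed a b es} → Walks.Walk allowed (src G) (tgt G) a b es → IsWalk G a b es
  walk⇒isWalk nil            = nil
  walk⇒isWalk (cons _ se w)  = cons se (walk⇒isWalk w)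

  paths⇒flow : ∀ {P k r t} → ((paths , _) : DisjointPaths P k r t) →
    Σ Flow λ f → IsFlow f k r t × (∀ e → f e ≡ true → Σ (Fin k) λ i → e ∈ paths i)
  paths⇒flow {k = zero} {r} {t} _ = (λ _ → false) , empty-isFlow r t , (λ _ ())
  paths⇒flow {k = suc k} (paths , ok , disjoint) with paths⇒flow (paths ∘ suc , ok ∘ suc , disjoint-rest)
    where
    disjoint-rest : ∀ i j → i ≢ j → ∀ e → e ∈ paths (suc i) → e ∈ paths (suc j) → ⊥
    disjoint-rest i j i≢j = disjoint (suc i) (suc j) (i≢j ∘ suc-injective)
  ... | f , flow , used = toggleAll f p , isFlow-augment {j = k} augments flow , used′
    where
    p : List E
    p = paths zero
    unused : ∀ {e} → e ∈ p → f e ≡ false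
    unused {e} e∈p with f e in fe
    ... | false = refl
    ... | true  = let (i , e∈) = used e fe in ⊥-elim (disjoint zero (suc i) (λ ()) e e∈p e∈)
    oriented : ∀ {e} → e ∈ p → Oriented (src G) (tgt G) e (f e)
    oriented e∈p rewrite unused e∈p = refl , refl
    augments : Augments f (toggleAll f p) _ _
    augments = let (w , _ , simple) = ok zero in
      augment-along {allowed = λ _ → true} f (isWalk⇒walk w (All.universal (λ _ → refl) p))
                    (Walks.simple⇒unique (λ _ → true) (src G) (tgt G) simple) (All.tabulate oriented)
    used′ : ∀ e → toggleAll f p e ≡ true → Σ (Fin (suc k)) λ i → e ∈ paths i
    used′ e on with e ∈? p
    ... | yes e∈p = zero , e∈p
    ... | no  e∉p = let (i , e∈) = used e (trans (sym (toggleAll-∉ f p e∉p)) on) in suc i , e∈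

  -- Weak duality: if r ∉ W and t ∈ W, each of k edge-disjoint r→t paths of h
  -- enters W, so at least k edges of h enter W.
  paths⇒cut-bound : ∀ {h k r t} → DisjointPaths (λ e → h e ≡ true) k r t →
    ∀ W → W r ≡ false → W t ≡ true → k ≤ entering h W
  paths⇒cut-bound {h} {k} paths@(_ , ok , _) W r∉W t∈W with paths⇒flow paths
  ... | f , flow , used = +-cancelˡ-≤ leaving k (entering h W) (begin
    leaving + k                                       ≡⟨ flow-across-cut W flow r∉W t∈W ⟨
    sum (λ e → χ (f e ∧ W (tgt G e)))                 ≤⟨ sum-mono (λ e → enters (f e) (h e) (W (src G e)) (W (tgt G e)) (f⊆h e)) ⟩
    sum (λ e → χ (f e ∧ W (src G e)) + χ (h e ∧ not (W (src G e)) ∧ W (tgt G e)))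
                                                      ≡⟨ ∑-distrib-+ (λ e → χ (f e ∧ W (src G e))) _ ⟩
    leaving + entering h W                            ∎)
    where
    open ≤-Reasoning
    leaving : ℕ
    leaving = sum (λ e → χ (f e ∧ W (src G e)))
    f⊆h : ∀ e → f e ≡ true → h e ≡ true
    f⊆h e fe = let (i , e∈) = used e fe in All.lookup (proj₁ (proj₂ (ok i))) e∈
    -- A flow edge with head in W has its tail in W, or it is an edge of h entering W.
    enters : ∀ fb hb ws wt → (fb ≡ true → hb ≡ true) → χ (fb ∧ wt) ≤ χ (fb ∧ ws) + χ (hb ∧ not ws ∧ wt)
    enters false _    _     _     _   = z≤n
    enters true  _    true  true  _   = s≤s z≤n
    enters true  _    true  false _   = z≤n
    enters true  _    false false _   = z≤n
    enters true  hb   false true  f⊆h rewrite f⊆h refl = ≤-refl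

  -- A flow of positive value leaves every vertex set containing r but not t, so
  -- no such set is closed under the flow edges.
  no-closed-separator : ∀ {f j r t R} → IsFlow f (suc j) r t → R r ≡ true → R t ≡ false →
    ¬ Walks.Closed f (src G) (tgt G) R
  no-closed-separator {f} {j} {r} {t} {R} flow r∈R t∉R closed = <⇒≱ more fewer
    where
    W : V → Bool
    W x = not (R x)
    more : sum (λ e → χ (f e ∧ W (src G e))) < sum (λ e → χ (f e ∧ W (tgt G e)))
    more = ≤-trans (≤-reflexive (sym (+-identityʳ _)))
             (≤-trans (+-monoʳ-< _ (s≤s z≤n)) (≤-reflexive (sym (flow-across-cut W flow (cong not r∈R) (cong not t∉R)))))
    stays : ∀ fb rs rt → (fb ≡ true → rs ≡ true → rt ≡ true) → χ (fb ∧ not rt) ≤ χ (fb ∧ not rs)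
    stays false _     _     _      = z≤n
    stays true  true  true  _      = z≤n
    stays true  true  false closed = contradiction (closed refl refl) λ ()
    stays true  false true  _      = z≤n
    stays true  false false _      = ≤-refl
    fewer : sum (λ e → χ (f e ∧ W (tgt G e))) ≤ sum (λ e → χ (f e ∧ W (src G e)))
    fewer = sum-mono (λ e → stays (f e) (R (src G e)) (R (tgt G e)) (closed e))

  flow⇒paths : ∀ {f} j {r t} → IsFlow f j r t → DisjointPaths (λ e → f e ≡ true) j r t
  flow⇒paths zero _ = (λ ()) , (λ ()) , (λ ())
  flow⇒paths {f} (suc j) {r} {t} flow with Walks.reach f (src G) (tgt G) r t
  ... | inj₂ (R , r∈R , t∉R , closed) = ⊥-elim (no-closed-separator flow r∈R t∉R closed)
  ... | inj₁ (_ , w) with Walks.shorten f (src G) (tgt G) w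
  ...   | p , w′ , simple =
    add-path (walk⇒isWalk w′ , walk-allowed w′ , simple) f′⊆f switched-off (flow⇒paths j flow′)
    where
    open Walks f (src G) (tgt G) using (walk-allowed; simple⇒unique)
    f′ : Flow
    f′ = toggleAll f p
    flow′ : IsFlow f′ j r t
    flow′ = isFlow-diminish (remove-along f (walk⇒isWalk w′) (simple⇒unique simple)
                                          (walk-allowed w′)) flow
    switched-off : ∀ {e} → e ∈ p → f′ e ≢ true
    switched-off e∈p on =
      contradiction (trans (sym (toggleAll-∈ f (simple⇒unique simple) e∈p)) on)
                    (λ not-fe → contradiction (All.lookup (walk-allowed w′) e∈p) (λ fe → case fe not-fe))
      where
      case : ∀ {b} → b ≡ true → not b ≢ true
      case refl ()
    f′⊆f : ∀ e → f′ e ≡ true → f e ≡ true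
    f′⊆f e on with e ∈? p
    ... | yes e∈p = All.lookup (walk-allowed w′) e∈p
    ... | no  e∉p = trans (sym (toggleAll-∉ f p e∉p)) on

  -- The residual graph of a flow f inside h: an edge of h unused by f may be
  -- traversed forwards, an edge used by f backwards.
  residual-src residual-tgt : Flow → E → V
  residual-src f e = if f e then tgt G e else src G e
  residual-tgt f e = if f e then src G e else tgt G e

  residual-oriented : ∀ f e → Oriented (residual-src f) (residual-tgt f) e (f e)
  residual-oriented f e with f e in fe
  ... | false = cong (λ b → if b then tgt G e else src G e) fe , cong (λ b → if b then src G e else tgt G e) fe
  ... | true  = cong (λ b → if b then tgt G e else src G e) fe , cong (λ b → if b then src G e else tgt G e) fe

  -- If the vertices reachable from r in the residual graph miss t, then the edges of h
  -- entering their complement are exactly the flow value: every such edge carries flow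
  -- and no flow edge leaves the complement.
  residual-cut : ∀ {h f j r t R} → (∀ e → f e ≡ true → h e ≡ true) → IsFlow f j r t →
    R r ≡ true → R t ≡ false → Walks.Closed h (residual-src f) (residual-tgt f) R →
    entering h (not ∘ R) ≡ j
  residual-cut {h} {f} {j} {r} {t} {R} f⊆h flow r∈R t∉R closed =
    +-cancelˡ-≡ leaving _ _ (trans (sym balanced) (flow-across-cut W flow (cong not r∈R) (cong not t∉R)))
    where
    W : V → Bool
    W = not ∘ R
    leaving : ℕ
    leaving = sum (λ e → χ (f e ∧ W (src G e)))
    forward : ∀ e → f e ≡ false → h e ≡ true → R (src G e) ≡ true → R (tgt G e) ≡ true
    forward e fe he rs = subst (λ b → R (if b then src G e else tgt G e) ≡ true) fe
      (closed e he (subst (λ b → R (if b then tgt G e else src G e) ≡ true) (sym fe) rs))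
    backward : ∀ e → f e ≡ true → R (tgt G e) ≡ true → R (src G e) ≡ true
    backward e fe rt = subst (λ b → R (if b then src G e else tgt G e) ≡ true) fe
      (closed e (f⊆h e fe) (subst (λ b → R (if b then tgt G e else src G e) ≡ true) (sym fe) rt))
    -- Per edge: a flow edge with head in W has its tail in W, or it enters W,
    -- and every edge of h entering W carries flow.
    split : ∀ fb hb rs rt → (fb ≡ true → hb ≡ true) → (fb ≡ false → hb ≡ true → rs ≡ true → rt ≡ true) →
      (fb ≡ true → rt ≡ true → rs ≡ true) →
      χ (fb ∧ not rt) ≡ χ (fb ∧ not rs) + χ (hb ∧ not (not rs) ∧ not rt)
    split true  false _     _     f⊆h _   _   = contradiction (f⊆h refl) λ ()
    split true  true  true  true  _   _   _   = refl
    split true  true  true  false _   _   _   = refl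
    split true  true  false true  _   _   bwd = contradiction (bwd refl refl) λ ()
    split true  true  false false _   _   _   = refl
    split false false _     _     _   _   _   = refl
    split false true  true  true  _   _   _   = refl
    split false true  true  false _   fwd _   = contradiction (fwd refl refl refl) λ ()
    split false true  false _     _   _   _   = refl
    balanced : sum (λ e → χ (f e ∧ W (tgt G e))) ≡ leaving + entering h W
    balanced = trans (sum-cong-≗ (λ e → split (f e) (h e) (R (src G e)) (R (tgt G e)) (f⊆h e) (forward e) (backward e)))
                     (∑-distrib-+ (λ e → χ (f e ∧ W (src G e))) _)

  SmallCut : (E → Bool) → ℕ → V → V → Set
  SmallCut h k r t = Σ (V → Bool) λ W → W r ≡ false × W t ≡ true × entering h W < k

  -- Augmenting-path method: starting from a flow of value j inside h, repeatedly
  -- augment along a simple residual path; if none exists we have found a small cut.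
  -- After k − j augmentations the flow decomposes into k disjoint paths.
  augment : ∀ {h k r t f} j fuel → j + fuel ≡ k → (∀ e → f e ≡ true → h e ≡ true) → IsFlow f j r t →
    DisjointPaths (λ e → h e ≡ true) k r t ⊎ SmallCut h k r t
  augment {h} {r = r} {t} j zero refl f⊆h flow =
    inj₁ (subst (λ k → DisjointPaths _ k r t) (sym (+-identityʳ j))
                (disjointPaths-weaken f⊆h (flow⇒paths j flow)))
  augment {h} {r = r} {t} {f} j (suc fuel) j+fuel≡k f⊆h flow
    with Walks.reach h (residual-src f) (residual-tgt f) r t
  ... | inj₂ (R , r∈R , t∉R , closed) =
    inj₂ (not ∘ R , cong not r∈R , cong not t∉R ,
          subst (_< _) (sym (residual-cut f⊆h flow r∈R t∉R closed))
                (subst (j <_) j+fuel≡k (m<m+n j (s≤s z≤n))))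
  ... | inj₁ (_ , w) with Walks.shorten h (residual-src f) (residual-tgt f) w
  ...   | p , w′ , simple =
    augment (suc j) fuel (trans (sym (+-suc j fuel)) j+fuel≡k) f′⊆h
            (isFlow-augment (augment-along f w′ (simple⇒unique simple) (All.tabulate (λ _ → residual-oriented f _))) flow)
    where
    open Walks h (residual-src f) (residual-tgt f) using (walk-allowed; simple⇒unique)
    f′⊆h : ∀ e → toggleAll f p e ≡ true → h e ≡ true
    f′⊆h e on with e ∈? p
    ... | yes e∈p = All.lookup (walk-allowed w′) e∈p
    ... | no  e∉p = f⊆h e (trans (sym (toggleAll-∉ f p e∉p)) on)

  menger : ∀ h k r t → DisjointPaths (λ e → h e ≡ true) k r t ⊎ SmallCut h k r t
  menger h k r t = augment 0 k refl (λ _ ()) (empty-isFlow r t)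

module MinimalSolutions (G : Digraph) (r : Fin (n G)) (T : Subset (n G)) (k : ℕ) where
  open Flows G using (V; E)
  open Cuts G
  open Menger G

  feasible⇒cut-bound : ∀ {H} → Feasible G r T k H → ∀ W {t} → t ∈ₛ T → W r ≡ false → W t ≡ true →
    k ≤ entering (edges H) W
  feasible⇒cut-bound feasible W t∈T =
    paths⇒cut-bound (disjointPaths-weaken (λ _ → []=⇒lookup) (feasible _ t∈T)) W

  infeasible⇒small-cut : ∀ {H} → ¬ Feasible G r T k H → Σ V λ t → t ∈ₛ T × SmallCut (edges H) k r t
  infeasible⇒small-cut {H} infeasible with all-or-some per-terminal
    where
    per-terminal : ∀ t → (t ∈ₛ T → HasDisjointPaths G H k r t) ⊎ (t ∈ₛ T × SmallCut (edges H) k r t)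
    per-terminal t with t ∈ₛ? T | menger (edges H) k r t
    ... | no  t∉T | _          = inj₁ (⊥-elim ∘ t∉T)
    ... | yes _   | inj₁ paths = inj₁ (λ _ → disjointPaths-weaken (λ e → lookup⇒[]= e H) paths)
    ... | yes t∈T | inj₂ cut   = inj₂ (t∈T , cut)
  ... | inj₁ feasible = ⊥-elim (infeasible feasible)
  ... | inj₂ found    = found

  record TightCut (H : EdgeSet G) (e : E) : Set where
    field
      set        : V → Bool
      root∉      : set r ≡ false
      tail∉      : set (src G e) ≡ false
      head∈      : set (tgt G e) ≡ true
      tight      : entering (edges H) set ≤ k
      terminal   : V
      terminal∈T : terminal ∈ₛ T
      terminal∈  : set terminal ≡ true

  -- Every edge e of a minimal solution has a tight cut: deleting e makes some cut
  -- small, while the cuts of H itself are large, so e enters that cut and the cut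
  -- loses exactly one edge.
  minimal⇒tight-cut : ∀ {H e} → Minimal G r T k H → e ∈ₛ H → TightCut H e
  minimal⇒tight-cut {H} {e} (feasible , minimal) e∈H with infeasible⇒small-cut (minimal e e∈H)
  ... | t , t∈T , W , r∉W , t∈W , small = record
    { set = W ; root∉ = r∉W ; tail∉ = proj₁ (crossing-ends crossing) ; head∈ = proj₂ (crossing-ends crossing)
    ; tight = subst (_≤ k) (trans (+-comm 1 _) (removed crossing)) small
    ; terminal = t ; terminal∈T = t∈T ; terminal∈ = t∈W }
    where
    removed : ∀ {b} → (not (W (src G e)) ∧ W (tgt G e)) ≡ b → entering (edges (H - e)) W + χ b ≡ entering (edges H) W
    removed c = subst (λ b → entering (edges (H - e)) W + χ b ≡ _) c (entering-remove e∈H W)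
    crossing : (not (W (src G e)) ∧ W (tgt G e)) ≡ true
    crossing with not (W (src G e)) ∧ W (tgt G e) in c
    ... | true  = refl
    ... | false = contradiction (feasible⇒cut-bound feasible W t∈T r∉W t∈W)
                    (<⇒≱ (subst (_< k) (trans (sym (+-identityʳ _)) (removed c)) small))
    crossing-ends : ∀ {a b} → (not a ∧ b) ≡ true → a ≡ false × b ≡ true
    crossing-ends {false} {true} _ = refl , refl

  -- Uncrossing: the union of a tight cut C with a set Z missing the root contains a
  -- terminal, so it is entered by at least k edges; by submodularity the intersection
  -- of C and Z is then entered by at most as many edges as Z.
  uncross : ∀ {H e Z} → Feasible G r T k H → (C : TightCut H e) → Z r ≡ false →
    entering (edges H) (λ x → TightCut.set C x ∧ Z x) ≤ entering (edges H) Z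
  uncross {H} {e} {Z} feasible C r∉Z = +-cancelʳ-≤ k _ _ (begin
    entering (edges H) C∧Z + k                             ≤⟨ +-monoʳ-≤ _ union-large ⟩
    entering (edges H) C∧Z + entering (edges H) C∨Z        ≤⟨ entering-submodular (edges H) set Z ⟩
    entering (edges H) set + entering (edges H) Z          ≤⟨ +-monoˡ-≤ _ tight ⟩
    k + entering (edges H) Z                               ≡⟨ +-comm k _ ⟩
    entering (edges H) Z + k                               ∎)
    where
    open TightCut C
    open ≤-Reasoning
    C∧Z C∨Z : V → Bool
    C∧Z x = set x ∧ Z x
    C∨Z x = set x ∨ Z x
    union-large : k ≤ entering (edges H) C∨Z
    union-large = feasible⇒cut-bound feasible C∨Z terminal∈T (cong₂ _∨_ root∉ r∉Z) (cong (_∨ Z terminal) terminal∈)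

  -- The sets obtained by intersecting tight cuts: all of V, or a set missing the
  -- root that is entered by at most k edges.
  Bounded : EdgeSet G → (V → Bool) → Set
  Bounded H Z = (∀ x → Z x ≡ true) ⊎ (Z r ≡ false × entering (edges H) Z ≤ k)

  bounded-∧ : ∀ {H e Z} → Feasible G r T k H → (C : TightCut H e) → Bounded H Z →
    Bounded H (λ x → TightCut.set C x ∧ Z x)
  bounded-∧ {H} {Z = Z} feasible C (inj₁ full) =
    inj₂ (cong (_∧ Z r) root∉ , subst (_≤ k) (entering-cong (edges H) same) tight)
    where
    open TightCut C
    same : ∀ x → set x ≡ set x ∧ Z x
    same x = trans (sym (∧-identityʳ _)) (cong (set x ∧_) (sym (full x)))
  bounded-∧ {Z = Z} feasible C (inj₂ (r∉Z , bound)) =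
    inj₂ (cong (_∧ Z r) (TightCut.root∉ C) , ≤-trans (uncross feasible C r∉Z) bound)

  module IndegreeBound {H : EdgeSet G} (minimal : Minimal G r T k H) (v : V) where

    into-v : E → Bool
    into-v e = edges H e ∧ (tgt G e ≡ᵇ v)

    Choice : E → Set
    Choice e = into-v e ≡ false ⊎ (TightCut H e × tgt G e ≡ v)

    choose : ∀ e → Choice e
    choose e with edges H e in e∈H | tgt G e ≡ᵇ v in head≡v
    ... | true  | true  = inj₂ (minimal⇒tight-cut minimal (lookup⇒[]= e H e∈H) , ≡ᵇ-sound head≡v)
    ... | true  | false = inj₁ refl
    ... | false | _     = inj₁ refl

    cutOf : ∀ {e} → Choice e → V → Bool
    cutOf (inj₁ _)       _ = true
    cutOf (inj₂ (C , _))   = TightCut.set C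

    ⋂ : List E → V → Bool
    ⋂ []       x = true
    ⋂ (e ∷ es) x = cutOf (choose e) x ∧ ⋂ es x

    ⋂-bounded : ∀ es → Bounded H (⋂ es)
    ⋂-bounded []       = inj₁ λ _ → refl
    ⋂-bounded (e ∷ es) with choose e
    ... | inj₁ _       = ⋂-bounded es
    ... | inj₂ (C , _) = bounded-∧ (proj₁ minimal) C (⋂-bounded es)

    ⋂-contains-v : ∀ es → ⋂ es v ≡ true
    ⋂-contains-v []       = refl
    ⋂-contains-v (e ∷ es) with choose e
    ... | inj₁ _          = ⋂-contains-v es
    ... | inj₂ (C , refl) = cong₂ _∧_ (TightCut.head∈ C) (⋂-contains-v es)

    ⋂-misses-tail : ∀ {e es} → e ∈ es → into-v e ≡ true → ⋂ es (src G e) ≡ false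
    ⋂-misses-tail {e} (here refl) into with choose e
    ... | inj₁ not-into   = contradiction (trans (sym not-into) into) λ ()
    ... | inj₂ (C , _)    = cong (_∧ _) (TightCut.tail∉ C)
    ⋂-misses-tail {e} {e′ ∷ es} (there e∈es) into =
      trans (cong (cutOf (choose e′) (src G e) ∧_) (⋂-misses-tail e∈es into)) (∧-zeroʳ _)

    Z : V → Bool
    Z = ⋂ (allFin (m G))

    Z-bound : entering (edges H) Z ≤ k
    Z-bound with ⋂-bounded (allFin (m G))
    ... | inj₂ (_ , bound) = bound
    ... | inj₁ full        = ≤-trans (≤-reflexive (entering-full (edges H) full)) z≤n

    into-v≤entering : sum (χ ∘ into-v) ≤ entering (edges H) Z
    into-v≤entering = sum-mono λ e → enters e (into-v e) refl
      where
      enters : ∀ e b → into-v e ≡ b → χ b ≤ χ (edges H e ∧ not (Z (src G e)) ∧ Z (tgt G e))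
      enters e false _    = z≤n
      enters e true  into with ∧-true into
      ... | e∈H , head≡ᵇv = ≤-reflexive (crossing e∈H (⋂-misses-tail (∈-allFin e) into) head∈Z)
        where
        head∈Z : Z (tgt G e) ≡ true
        head∈Z = subst (λ x → Z x ≡ true) (sym (≡ᵇ-sound head≡ᵇv)) (⋂-contains-v (allFin (m G)))
        crossing : ∀ {a b c} → a ≡ true → b ≡ false → c ≡ true → 1 ≡ χ (a ∧ not b ∧ c)
        crossing refl refl refl = refl

    indeg-as-sum : indeg G H v ≡ sum (χ ∘ into-v)
    indeg-as-sum = trans (∣∣-as-sum (H ∩ tabulate (λ e → tgt G e ≡ᵇ v)))
      (sum-cong-≗ λ e → cong χ (trans (lookup-zipWith _∧_ e H _) (cong (lookup H e ∧_) (lookup∘tabulate _ e))))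

    indegree-bound : indeg G H v ≤ k
    indegree-bound = begin
      indeg G H v                ≡⟨ indeg-as-sum ⟩
      sum (χ ∘ into-v)           ≤⟨ into-v≤entering ⟩
      entering (edges H) Z       ≤⟨ Z-bound ⟩
      k                          ∎
      where open ≤-Reasoning

corollary5 : (G : Digraph) (r : Fin (n G)) (T : Subset (n G)) (k : ℕ) →
    1 ≤ k → (H : EdgeSet G) → Minimal G r T k H →
    (v : Fin (n G)) → indeg G H v ≤ k
corollary5 G r T k _ H minimal v = IndegreeBound.indegree-bound minimal v
  where open MinimalSolutions G r T k
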